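{- For every integer $n\ge1$, \[ \sum_{k=1}^{n}k\,\omega(n-k)=\sum_{\substack{m+k=n\\ m\ge 1,\ k\ge 0}}\phi(m)\sum_{j\ge0}\omega(k-jm), \] where $\phi$ is Euler's totient function.
   Context: For integers $m$, $\omega(m)=1$ if $m=0$; $\omega(m)=(-1)^i$ if $m=\frac{3i^2\pm i}{2}$ for some positive integer $i$; $\omega(m)=0$ otherwise (in particular for $m<0$). -}

module Defs where

open import Data.Nat as ℕ using (ℕ; zero; suc; _∸_)
open import Data.Nat.GCD using (gcd)
open import Data.Integer as ℤ using (ℤ; +_; -[1+_])
open import Data.List using (List; map; upTo; foldr; filter; length)
open import Data.Bool using (Bool; true; false; if_then_else_; _∨_)
open import Relation.Nullary.Decidable using (⌊_⌋)

range : ℕ → ℕ → List ℕ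
range a b = map (a ℕ.+_) (upTo (suc b ∸ a))

sumℤ : ℕ → ℕ → (ℕ → ℤ) → ℤ
sumℤ a b f = foldr ℤ._+_ (+ 0) (map f (range a b))

φ : ℕ → ℕ
φ m = length (filter (λ k → gcd k m ℕ.≟ 1) (range 1 m))

sgnPow : ℕ → ℤ
sgnPow zero = + 1
sgnPow (suc i) = ℤ.- sgnPow i

isPent : ℕ → ℕ → Bool
isPent m i = ⌊ 2 ℕ.* m ℕ.≟ 3 ℕ.* (i ℕ.* i) ℕ.+ i ⌋ ∨ ⌊ 2 ℕ.* m ℕ.+ i ℕ.≟ 3 ℕ.* (i ℕ.* i) ⌋

-- search positive i ≤ fuel with m = (3i² ± i)/2 (pentagonal numbers are distinct,
-- and such i satisfies i ≤ m, so fuel = m suffices)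
pentSearch : ℕ → ℕ → ℤ
pentSearch m zero = + 0
pentSearch m (suc i) = if isPent m (suc i) then sgnPow (suc i) else pentSearch m i

-- ω(m): 1 if m = 0; (-1)^i if m = (3i² ± i)/2, i ≥ 1; 0 otherwise (incl. m < 0)
ω : ℤ → ℤ
ω (+ zero) = + 1
ω (+ suc m) = pentSearch (suc m) (suc m)
ω -[1+ _ ] = + 0

{-# OPTIONS --safe #-}
-- Expanding k = Σ_{m ∣ k} φ(m) (Gauss) and exchanging the two sums turns the left side into
-- Σ_m φ(m) Σ_{k ≤ n, m ∣ k} ω(n − k). Writing k = (j + 1) m gives the inner sums of the right
-- side, whose extra terms (those with k > n) vanish because ω is zero on negative arguments;
-- nothing else about ω is used.
module Submission where

open import Defs
open import Data.Nat using (ℕ; _≥_; _∸_)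
open import Data.Integer using (ℤ; +_; _*_; _-_)
open import Relation.Binary.PropositionalEquality using (_≡_)

import Data.Integer.Properties as ℤₚ
open import Algebra.Properties.Semiring.Sum ℤₚ.+-*-semiring
  using (sum; sum-cong-≗; sum-init-last; sum-replicate-zero; ∑-comm; *-distribˡ-sum; *-distribʳ-sum)
open import Data.Bool using (if_then_else_)
open import Data.Fin using (toℕ)
open import Data.Fin.Properties using (toℕ<n; toℕ-inject₁; toℕ-fromℕ)
open import Data.Integer as ℤ using (_+_; _⊖_; -[1+_]; 0ℤ; 1ℤ)
open import Data.List using (List; []; _∷_; map; foldr; filter; length; applyUpTo)
open import Data.Nat as ℕ
  using (zero; suc; pred; _≤_; _<_; z≤n; s≤s; NonZero; >-nonZero; >-nonZero⁻¹; _≟_)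
import Data.Nat.Properties as ℕₚ
open import Data.Nat.Divisibility using (_∣_; divides; divides-refl; _∣?_; ∣m+n∣m⇒∣n; n∣m*n; ∣⇒≤)
open import Data.Nat.GCD using (gcd; gcd[m,n]∣m; gcd[m,n]∣n; c*gcd[m,n]≡gcd[cm,cn])
open import Function using (_∘_; id; _⇔_; mk⇔)
open import Relation.Binary.PropositionalEquality
  using (refl; sym; trans; cong; cong₂; subst; _≢_; module ≡-Reasoning)
open import Relation.Nullary using (Dec; yes; no; does; ¬_)
open import Relation.Nullary.Decidable using (dec-true; dec-false; does-⇔)
open import Relation.Unary using (Pred; Decidable)

open ≡-Reasoning

∑₁ : ℕ → (ℕ → ℤ) → ℤ
∑₁ n f = sum {n} (λ i → f (suc (toℕ i)))

∑₁-cong : ∀ n {f g : ℕ → ℤ} → (∀ i → 1 ≤ i → i ≤ n → f i ≡ g i) → ∑₁ n f ≡ ∑₁ n g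
∑₁-cong n f≡g = sum-cong-≗ (λ i → f≡g (suc (toℕ i)) (s≤s z≤n) (toℕ<n i))

∑₁-zero : ∀ n {f : ℕ → ℤ} → (∀ i → 1 ≤ i → i ≤ n → f i ≡ 0ℤ) → ∑₁ n f ≡ 0ℤ
∑₁-zero n f≡0 = trans (∑₁-cong n f≡0) (sum-replicate-zero n)

∑₁-suc : ∀ n (f : ℕ → ℤ) → ∑₁ (suc n) f ≡ ∑₁ n f + f (suc n)
∑₁-suc n f = trans (sum-init-last {n} (λ i → f (suc (toℕ i))))
  (cong₂ _+_ (sum-cong-≗ {n} (cong (f ∘ suc) ∘ toℕ-inject₁)) (cong (f ∘ suc) (toℕ-fromℕ n)))

∑₁-comm : ∀ m n (f : ℕ → ℕ → ℤ) → ∑₁ m (λ i → ∑₁ n (f i)) ≡ ∑₁ n (λ j → ∑₁ m (λ i → f i j))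
∑₁-comm m n f = ∑-comm {m} {n} (λ i j → f (suc (toℕ i)) (suc (toℕ j)))

*-distribˡ-∑₁ : ∀ n x (f : ℕ → ℤ) → x * ∑₁ n f ≡ ∑₁ n (λ i → x * f i)
*-distribˡ-∑₁ n x f = *-distribˡ-sum {n} x (λ i → f (suc (toℕ i)))

*-distribʳ-∑₁ : ∀ n x (f : ℕ → ℤ) → ∑₁ n f * x ≡ ∑₁ n (λ i → f i * x)
*-distribʳ-∑₁ n x f = *-distribʳ-sum {n} x (λ i → f (suc (toℕ i)))

∑₁-interchange : ∀ n (c : ℕ → ℤ) (d : ℕ → ℕ → ℤ) (A : ℕ → ℤ) →
                 ∑₁ n (λ k → ∑₁ n (λ m → c m * d m k) * A k) ≡ ∑₁ n (λ m → c m * ∑₁ n (λ k → d m k * A k))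
∑₁-interchange n c d A = begin
  ∑₁ n (λ k → ∑₁ n (λ m → c m * d m k) * A k)
    ≡⟨ ∑₁-cong n (λ k _ _ → *-distribʳ-∑₁ n (A k) (λ m → c m * d m k)) ⟩
  ∑₁ n (λ k → ∑₁ n (λ m → c m * d m k * A k))
    ≡⟨ ∑₁-comm n n (λ k m → c m * d m k * A k) ⟩
  ∑₁ n (λ m → ∑₁ n (λ k → c m * d m k * A k))
    ≡⟨ ∑₁-cong n (λ m _ _ → ∑₁-cong n (λ k _ _ → ℤₚ.*-assoc (c m) (d m k) (A k))) ⟩
  ∑₁ n (λ m → ∑₁ n (λ k → c m * (d m k * A k)))
    ≡⟨ ∑₁-cong n (λ m _ _ → *-distribˡ-∑₁ n (c m) (λ k → d m k * A k)) ⟨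
  ∑₁ n (λ m → c m * ∑₁ n (λ k → d m k * A k)) ∎

∑₁-1 : ∀ n → ∑₁ n (λ _ → 1ℤ) ≡ + n
∑₁-1 zero    = refl
∑₁-1 (suc n) = trans (cong (_+_ 1ℤ) (∑₁-1 n)) (sym (ℤₚ.pos-+ 1 n))

∑₁-split : ∀ m n (f : ℕ → ℤ) → ∑₁ (m ℕ.+ n) f ≡ ∑₁ m f + ∑₁ n (λ i → f (m ℕ.+ i))
∑₁-split m zero f = begin
  ∑₁ (m ℕ.+ 0) f ≡⟨ cong (λ k → ∑₁ k f) (ℕₚ.+-identityʳ m) ⟩
  ∑₁ m f         ≡⟨ ℤₚ.+-identityʳ (∑₁ m f) ⟨
  ∑₁ m f + 0ℤ    ∎
∑₁-split m (suc n) f = begin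
  ∑₁ (m ℕ.+ suc n) f                 ≡⟨ cong (λ k → ∑₁ k f) (ℕₚ.+-suc m n) ⟩
  ∑₁ (suc (m ℕ.+ n)) f               ≡⟨ ∑₁-suc (m ℕ.+ n) f ⟩
  ∑₁ (m ℕ.+ n) f + f (suc (m ℕ.+ n)) ≡⟨ cong₂ _+_ (∑₁-split m n f) (cong f (sym (ℕₚ.+-suc m n))) ⟩
  ∑₁ m f + ∑₁ n g + g (suc n)        ≡⟨ ℤₚ.+-assoc (∑₁ m f) (∑₁ n g) (g (suc n)) ⟩
  ∑₁ m f + (∑₁ n g + g (suc n))      ≡⟨ cong (_+_ (∑₁ m f)) (∑₁-suc n g) ⟨
  ∑₁ m f + ∑₁ (suc n) g              ∎
  where
  g = λ i → f (m ℕ.+ i)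

∑₁-extend : ∀ {m n} (f : ℕ → ℤ) → m ≤ n → (∀ i → m < i → i ≤ n → f i ≡ 0ℤ) → ∑₁ n f ≡ ∑₁ m f
∑₁-extend {m} {n} f m≤n f≡0 = begin
  ∑₁ n f                                  ≡⟨ cong (λ k → ∑₁ k f) (ℕₚ.m+[n∸m]≡n m≤n) ⟨
  ∑₁ (m ℕ.+ (n ∸ m)) f                    ≡⟨ ∑₁-split m (n ∸ m) f ⟩
  ∑₁ m f + ∑₁ (n ∸ m) (λ i → f (m ℕ.+ i)) ≡⟨ cong (_+_ (∑₁ m f)) (∑₁-zero (n ∸ m) tail≡0) ⟩
  ∑₁ m f + 0ℤ                             ≡⟨ ℤₚ.+-identityʳ (∑₁ m f) ⟩
  ∑₁ m f                                  ∎
  where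
  tail≡0 : ∀ i → 1 ≤ i → i ≤ n ∸ m → f (m ℕ.+ i) ≡ 0ℤ
  tail≡0 i 1≤i i≤n∸m = f≡0 (m ℕ.+ i)
    (ℕₚ.≤-trans (ℕₚ.≤-reflexive (ℕₚ.+-comm 1 m)) (ℕₚ.+-monoʳ-≤ m 1≤i))
    (ℕₚ.≤-trans (ℕₚ.+-monoʳ-≤ m i≤n∸m) (ℕₚ.≤-reflexive (ℕₚ.m+[n∸m]≡n m≤n)))

∑₁-single : ∀ {n c} (f : ℕ → ℤ) → 1 ≤ c → c ≤ n →
            (∀ i → 1 ≤ i → i ≤ n → i ≢ c → f i ≡ 0ℤ) → ∑₁ n f ≡ f c
∑₁-single {n} {suc c} f _ c<n f≡0 = begin
  ∑₁ n f             ≡⟨ ∑₁-extend f c<n above ⟩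
  ∑₁ (suc c) f       ≡⟨ ∑₁-suc c f ⟩
  ∑₁ c f + f (suc c) ≡⟨ cong (_+ f (suc c)) (∑₁-zero c below) ⟩
  0ℤ + f (suc c)     ≡⟨ ℤₚ.+-identityˡ (f (suc c)) ⟩
  f (suc c)          ∎
  where
  above : ∀ i → suc c < i → i ≤ n → f i ≡ 0ℤ
  above i c<i i≤n = f≡0 i (ℕₚ.≤-trans (s≤s z≤n) c<i) i≤n (ℕₚ.>⇒≢ c<i)
  below : ∀ i → 1 ≤ i → i ≤ c → f i ≡ 0ℤ
  below i 1≤i i≤c = f≡0 i 1≤i (ℕₚ.<⇒≤ (ℕₚ.<-≤-trans (s≤s i≤c) c<n)) (ℕₚ.<⇒≢ (s≤s i≤c))

∑₁-multiples : ∀ {e} q (h : ℕ → ℤ) .{{_ : NonZero e}} → (∀ t → ¬ e ∣ t → h t ≡ 0ℤ) →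
               ∑₁ (q ℕ.* e) h ≡ ∑₁ q (λ j → h (j ℕ.* e))
∑₁-multiples zero h _ = refl
∑₁-multiples {e} (suc q) h h≡0 = begin
  ∑₁ (e ℕ.+ q ℕ.* e) h
    ≡⟨ cong (λ k → ∑₁ k h) (ℕₚ.+-comm e (q ℕ.* e)) ⟩
  ∑₁ (q ℕ.* e ℕ.+ e) h
    ≡⟨ ∑₁-split (q ℕ.* e) e h ⟩
  ∑₁ (q ℕ.* e) h + ∑₁ e (λ i → h (q ℕ.* e ℕ.+ i))
    ≡⟨ cong₂ _+_ (∑₁-multiples q h h≡0) (∑₁-single _ (>-nonZero⁻¹ e) ℕₚ.≤-refl block≡0) ⟩
  ∑₁ q (λ j → h (j ℕ.* e)) + h (q ℕ.* e ℕ.+ e)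
    ≡⟨ cong (λ k → ∑₁ q (λ j → h (j ℕ.* e)) + h k) (ℕₚ.+-comm (q ℕ.* e) e) ⟩
  ∑₁ q (λ j → h (j ℕ.* e)) + h (suc q ℕ.* e)
    ≡⟨ ∑₁-suc q (λ j → h (j ℕ.* e)) ⟨
  ∑₁ (suc q) (λ j → h (j ℕ.* e)) ∎
  where
  block≡0 : ∀ i → 1 ≤ i → i ≤ e → i ≢ e → h (q ℕ.* e ℕ.+ i) ≡ 0ℤ
  block≡0 i@(suc _) _ i≤e i≢e = h≡0 _ λ e∣qe+i →
    ℕₚ.<-irrefl refl (ℕₚ.≤-<-trans (∣⇒≤ (∣m+n∣m⇒∣n e∣qe+i (n∣m*n q))) (ℕₚ.≤∧≢⇒< i≤e i≢e))

𝟙 : ∀ {p} {P : Set p} → Dec P → ℤ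
𝟙 P? = if does P? then 1ℤ else 0ℤ

module _ {p} {P : Set p} (P? : Dec P) where

  𝟙-yes : P → 𝟙 P? ≡ 1ℤ
  𝟙-yes x = cong (λ b → if b then 1ℤ else 0ℤ) (dec-true P? x)

  𝟙-no : ¬ P → 𝟙 P? ≡ 0ℤ
  𝟙-no ¬x = cong (λ b → if b then 1ℤ else 0ℤ) (dec-false P? ¬x)

  𝟙-⇔ : ∀ {q} {Q : Set q} (Q? : Dec Q) → P ⇔ Q → 𝟙 P? ≡ 𝟙 Q?
  𝟙-⇔ Q? P⇔Q = cong (λ b → if b then 1ℤ else 0ℤ) (does-⇔ P⇔Q P? Q?)

length-filter≡∑𝟙 : ∀ {a p} {A : Set a} {P : Pred A p} (P? : Decidable P) (xs : List A) →
                   + length (filter P? xs) ≡ foldr _+_ 0ℤ (map (𝟙 ∘ P?) xs)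
length-filter≡∑𝟙 P? [] = refl
length-filter≡∑𝟙 P? (x ∷ xs) with P? x
... | yes _ = trans (ℤₚ.pos-+ 1 _) (cong (_+_ 1ℤ) (length-filter≡∑𝟙 P? xs))
... | no _  = trans (length-filter≡∑𝟙 P? xs) (sym (ℤₚ.+-identityˡ _))

sumℤ≡∑₁ : ∀ a b (f : ℕ → ℤ) → sumℤ a b f ≡ ∑₁ (suc b ∸ a) (λ i → f (a ℕ.+ pred i))
sumℤ≡∑₁ a b f = foldr-applyUpTo (suc b ∸ a) id
  where
  foldr-applyUpTo : ∀ L (g : ℕ → ℕ) →
    foldr _+_ 0ℤ (map f (map (a ℕ.+_) (applyUpTo g L))) ≡ ∑₁ L (λ i → f (a ℕ.+ g (pred i)))
  foldr-applyUpTo zero    g = refl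
  foldr-applyUpTo (suc L) g = cong (_+_ (f (a ℕ.+ g 0))) (foldr-applyUpTo L (g ∘ suc))

φ≡∑₁ : ∀ m → + φ m ≡ ∑₁ m (λ k → 𝟙 (gcd k m ≟ 1))
φ≡∑₁ m = trans (length-filter≡∑𝟙 (λ k → gcd k m ≟ 1) (range 1 m)) (sumℤ≡∑₁ 1 m _)

∑₁-cofactor : ∀ {g t} .{{_ : NonZero t}} → g ∣ t → ∑₁ t (λ m → 𝟙 (m ℕ.* g ≟ t)) ≡ 1ℤ
∑₁-cofactor {g} (divides-refl q) = begin
  ∑₁ (q ℕ.* g) (λ m → 𝟙 (m ℕ.* g ≟ q ℕ.* g))
    ≡⟨ ∑₁-single (λ m → 𝟙 (m ℕ.* g ≟ q ℕ.* g)) (>-nonZero⁻¹ q) (ℕₚ.m≤m*n q g) others≡0 ⟩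
  𝟙 (q ℕ.* g ≟ q ℕ.* g)
    ≡⟨ 𝟙-yes (q ℕ.* g ≟ q ℕ.* g) refl ⟩
  1ℤ ∎
  where
  instance
    q≢0 : NonZero q
    q≢0 = ℕₚ.m*n≢0⇒m≢0 q
    g≢0 : NonZero g
    g≢0 = ℕₚ.m*n≢0⇒n≢0 q
  others≡0 : ∀ i → 1 ≤ i → i ≤ q ℕ.* g → i ≢ q → 𝟙 (i ℕ.* g ≟ q ℕ.* g) ≡ 0ℤ
  others≡0 i _ _ i≢q = 𝟙-no (i ℕ.* g ≟ q ℕ.* g) (i≢q ∘ ℕₚ.*-cancelʳ-≡ i q g)

-- For t = q m, the k with m · gcd k t = t are the k = a q with gcd a m = 1.
∑₁-gcd-cofactor : ∀ {t} m .{{_ : NonZero t}} →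
                  ∑₁ t (λ k → 𝟙 (m ℕ.* gcd k t ≟ t)) ≡ + φ m * 𝟙 (m ∣? t)
∑₁-gcd-cofactor {t} m with m ∣? t
... | no m∤t = begin
  ∑₁ t (λ k → 𝟙 (m ℕ.* gcd k t ≟ t)) ≡⟨ ∑₁-zero t (λ k _ _ → 𝟙-no (m ℕ.* gcd k t ≟ t) (m∤t ∘ m∣t k)) ⟩
  0ℤ                                 ≡⟨ ℤₚ.*-zeroʳ (+ φ m) ⟨
  + φ m * 0ℤ                         ∎
  where
  m∣t : ∀ k → m ℕ.* gcd k t ≡ t → m ∣ t
  m∣t k eq = divides (gcd k t) (trans (sym eq) (ℕₚ.*-comm m (gcd k t)))
... | yes (divides-refl q) = begin
  ∑₁ (q ℕ.* m) h               ≡⟨ cong (λ L → ∑₁ L h) (ℕₚ.*-comm q m) ⟩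
  ∑₁ (m ℕ.* q) h               ≡⟨ ∑₁-multiples m h off≡0 ⟩
  ∑₁ m (λ a → h (a ℕ.* q))     ≡⟨ ∑₁-cong m (λ a _ _ → 𝟙-⇔ (h? (a ℕ.* q)) (gcd a m ≟ 1) (coprime⇔ a)) ⟩
  ∑₁ m (λ a → 𝟙 (gcd a m ≟ 1)) ≡⟨ φ≡∑₁ m ⟨
  + φ m                        ≡⟨ ℤₚ.*-identityʳ (+ φ m) ⟨
  + φ m * 1ℤ                   ∎
  where
  instance
    q≢0 : NonZero q
    q≢0 = ℕₚ.m*n≢0⇒m≢0 q
    m≢0 : NonZero m
    m≢0 = ℕₚ.m*n≢0⇒n≢0 q
  h? : ∀ k → Dec (m ℕ.* gcd k (q ℕ.* m) ≡ q ℕ.* m)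
  h? k = m ℕ.* gcd k (q ℕ.* m) ≟ q ℕ.* m
  h : ℕ → ℤ
  h = 𝟙 ∘ h?
  off≡0 : ∀ k → ¬ q ∣ k → h k ≡ 0ℤ
  off≡0 k q∤k = 𝟙-no (h? k) λ eq →
    q∤k (subst (_∣ k) (ℕₚ.*-cancelˡ-≡ _ _ m (trans eq (ℕₚ.*-comm q m))) (gcd[m,n]∣m k (q ℕ.* m)))
  m*gcd≡q*m*gcd : ∀ a → m ℕ.* gcd (a ℕ.* q) (q ℕ.* m) ≡ q ℕ.* m ℕ.* gcd a m
  m*gcd≡q*m*gcd a = begin
    m ℕ.* gcd (a ℕ.* q) (q ℕ.* m) ≡⟨ cong (λ x → m ℕ.* gcd x (q ℕ.* m)) (ℕₚ.*-comm a q) ⟩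
    m ℕ.* gcd (q ℕ.* a) (q ℕ.* m) ≡⟨ cong (m ℕ.*_) (c*gcd[m,n]≡gcd[cm,cn] q a m) ⟨
    m ℕ.* (q ℕ.* gcd a m)         ≡⟨ ℕₚ.*-assoc m q (gcd a m) ⟨
    m ℕ.* q ℕ.* gcd a m           ≡⟨ cong (ℕ._* gcd a m) (ℕₚ.*-comm m q) ⟩
    q ℕ.* m ℕ.* gcd a m           ∎
  coprime⇔ : ∀ a → (m ℕ.* gcd (a ℕ.* q) (q ℕ.* m) ≡ q ℕ.* m) ⇔ (gcd a m ≡ 1)
  coprime⇔ a = mk⇔
    (λ eq → ℕₚ.*-cancelˡ-≡ _ 1 (q ℕ.* m)
              (trans (sym (m*gcd≡q*m*gcd a)) (trans eq (sym (ℕₚ.*-identityʳ _)))))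
    (λ eq → trans (m*gcd≡q*m*gcd a) (trans (cong (q ℕ.* m ℕ.*_) eq) (ℕₚ.*-identityʳ _)))

-- Each k ∈ [1, t] is counted once, by the divisor m = t / gcd k t of t (∑₁-cofactor), and
-- each divisor m is reached from exactly φ m values of k (∑₁-gcd-cofactor).
∑₁-φ-divisors : ∀ {t} n .{{_ : NonZero t}} → t ≤ n → ∑₁ n (λ m → + φ m * 𝟙 (m ∣? t)) ≡ + t
∑₁-φ-divisors {t} n t≤n = begin
  ∑₁ n (λ m → + φ m * 𝟙 (m ∣? t))                  ≡⟨ ∑₁-extend _ t≤n non-divisors≡0 ⟩
  ∑₁ t (λ m → + φ m * 𝟙 (m ∣? t))                  ≡⟨ ∑₁-cong t (λ m _ _ → ∑₁-gcd-cofactor m) ⟨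
  ∑₁ t (λ m → ∑₁ t (λ k → 𝟙 (m ℕ.* gcd k t ≟ t)))  ≡⟨ ∑₁-comm t t (λ m k → 𝟙 (m ℕ.* gcd k t ≟ t)) ⟩
  ∑₁ t (λ k → ∑₁ t (λ m → 𝟙 (m ℕ.* gcd k t ≟ t)))  ≡⟨ ∑₁-cong t (λ k _ _ → ∑₁-cofactor (gcd[m,n]∣n k t)) ⟩
  ∑₁ t (λ _ → 1ℤ)                                  ≡⟨ ∑₁-1 t ⟩
  + t                                              ∎
  where
  non-divisors≡0 : ∀ m → t < m → m ≤ n → + φ m * 𝟙 (m ∣? t) ≡ 0ℤ
  non-divisors≡0 m t<m _ = trans (cong (λ x → + φ m * x) (𝟙-no (m ∣? t) (ℕₚ.<⇒≱ t<m ∘ ∣⇒≤)))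
                                 (ℤₚ.*-zeroʳ (+ φ m))

[+m]-[+1+n]≡-[1+n∸m] : ∀ {m n} → m ≤ n → + m - + suc n ≡ -[1+ n ∸ m ]
[+m]-[+1+n]≡-[1+n∸m] {m} {n} m≤n = begin
  + m - + suc n     ≡⟨ ℤₚ.[+m]-[+n]≡m⊖n m (suc n) ⟩
  m ⊖ suc n         ≡⟨ ℤₚ.⊖-< (s≤s m≤n) ⟩
  ℤ.- + (suc n ∸ m) ≡⟨ cong (ℤ.-_ ∘ +_) (ℕₚ.+-∸-assoc 1 m≤n) ⟩
  -[1+ n ∸ m ]      ∎

[+n]-[+[m+x]]≡[+[n∸m]]-[+x] : ∀ {m n} x → m ≤ n → + n - + (m ℕ.+ x) ≡ + (n ∸ m) - + x
[+n]-[+[m+x]]≡[+[n∸m]]-[+x] {m} {n} x m≤n = begin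
  + n - + (m ℕ.+ x)         ≡⟨ ℤₚ.[+m]-[+n]≡m⊖n n (m ℕ.+ x) ⟩
  n ⊖ (m ℕ.+ x)             ≡⟨ cong (_⊖ (m ℕ.+ x)) (ℕₚ.m+[n∸m]≡n m≤n) ⟨
  m ℕ.+ (n ∸ m) ⊖ (m ℕ.+ x) ≡⟨ ℤₚ.+-cancelˡ-⊖ m (n ∸ m) x ⟩
  (n ∸ m) ⊖ x               ≡⟨ ℤₚ.[+m]-[+n]≡m⊖n (n ∸ m) x ⟨
  + (n ∸ m) - + x           ∎

module _ (a : ℤ → ℤ) (a-neg : ∀ d → a -[1+ d ] ≡ 0ℤ) where

  a[+n-+t]≡0 : ∀ {n t} → n < t → a (+ n - + t) ≡ 0ℤ
  a[+n-+t]≡0 {n} {suc t} (s≤s n≤t) = trans (cong a ([+m]-[+1+n]≡-[1+n∸m] n≤t)) (a-neg (t ∸ n))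

  ∑₁-multiples-of-m : ∀ {m} n .{{_ : NonZero m}} → m ≤ n →
    ∑₁ n (λ k → 𝟙 (m ∣? k) * a (+ n - + k)) ≡ ∑₁ (suc (n ∸ m)) (λ j → a (+ (n ∸ m) - + (pred j ℕ.* m)))
  ∑₁-multiples-of-m {m} n m≤n = begin
    ∑₁ n h                                        ≡⟨ ∑₁-extend h n≤q*m beyond-n≡0 ⟨
    ∑₁ (q ℕ.* m) h                                ≡⟨ ∑₁-multiples q h non-multiples≡0 ⟩
    ∑₁ q (λ j → h (j ℕ.* m))                      ≡⟨ ∑₁-cong q (λ j 1≤j _ → multiple j 1≤j) ⟩
    ∑₁ q (λ j → a (+ (n ∸ m) - + (pred j ℕ.* m))) ∎
    where
    q = suc (n ∸ m)
    h : ℕ → ℤ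
    h k = 𝟙 (m ∣? k) * a (+ n - + k)
    n≤q*m : n ≤ q ℕ.* m
    n≤q*m = ℕₚ.≤-trans (ℕₚ.≤-reflexive (sym (ℕₚ.m+[n∸m]≡n m≤n))) (ℕₚ.+-monoʳ-≤ m (ℕₚ.m≤m*n (n ∸ m) m))
    beyond-n≡0 : ∀ k → n < k → k ≤ q ℕ.* m → h k ≡ 0ℤ
    beyond-n≡0 k n<k _ = trans (cong (𝟙 (m ∣? k) *_) (a[+n-+t]≡0 n<k)) (ℤₚ.*-zeroʳ (𝟙 (m ∣? k)))
    non-multiples≡0 : ∀ k → ¬ m ∣ k → h k ≡ 0ℤ
    non-multiples≡0 k m∤k = cong (_* a (+ n - + k)) (𝟙-no (m ∣? k) m∤k)
    multiple : ∀ j → 1 ≤ j → h (j ℕ.* m) ≡ a (+ (n ∸ m) - + (pred j ℕ.* m))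
    multiple (suc j) _ = begin
      𝟙 (m ∣? suc j ℕ.* m) * a (+ n - + (m ℕ.+ j ℕ.* m))
        ≡⟨ cong (_* a (+ n - + (m ℕ.+ j ℕ.* m))) (𝟙-yes (m ∣? suc j ℕ.* m) (n∣m*n (suc j))) ⟩
      1ℤ * a (+ n - + (m ℕ.+ j ℕ.* m))
        ≡⟨ ℤₚ.*-identityˡ _ ⟩
      a (+ n - + (m ℕ.+ j ℕ.* m))
        ≡⟨ cong a ([+n]-[+[m+x]]≡[+[n∸m]]-[+x] (j ℕ.* m) m≤n) ⟩
      a (+ (n ∸ m) - + (j ℕ.* m)) ∎

  ∑₁-k*a[n-k]≡∑₁-φ*∑a[n-m-jm] : ∀ n →
    ∑₁ n (λ k → + k * a (+ n - + k))
      ≡ ∑₁ n (λ m → + φ m * ∑₁ (suc (n ∸ m)) (λ j → a (+ (n ∸ m) - + (pred j ℕ.* m))))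
  ∑₁-k*a[n-k]≡∑₁-φ*∑a[n-m-jm] n = begin
    ∑₁ n (λ k → + k * A k)
      ≡⟨ ∑₁-cong n (λ k 1≤k k≤n → cong (_* A k) (∑₁-φ-divisors n {{>-nonZero 1≤k}} k≤n)) ⟨
    ∑₁ n (λ k → ∑₁ n (λ m → + φ m * 𝟙 (m ∣? k)) * A k)
      ≡⟨ ∑₁-interchange n (λ m → + φ m) (λ m k → 𝟙 (m ∣? k)) A ⟩
    ∑₁ n (λ m → + φ m * ∑₁ n (λ k → 𝟙 (m ∣? k) * A k))
      ≡⟨ ∑₁-cong n (λ m 1≤m m≤n → cong (λ x → + φ m * x) (∑₁-multiples-of-m n {{>-nonZero 1≤m}} m≤n)) ⟩
    ∑₁ n (λ m → + φ m * ∑₁ (suc (n ∸ m)) (λ j → a (+ (n ∸ m) - + (pred j ℕ.* m)))) ∎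
    where
    A : ℕ → ℤ
    A k = a (+ n - + k)

mainTheorem8 : (n : ℕ) → n ≥ 1 →
    sumℤ 1 n (λ k → + k * ω (+ n - + k))
      ≡ sumℤ 1 n (λ m → + φ m * sumℤ 0 (n ∸ m) (λ j → ω (+ (n ∸ m) - + (j Data.Nat.* m))))
mainTheorem8 n _ = begin
  sumℤ 1 n (λ k → + k * ω (+ n - + k))
    ≡⟨ sumℤ≡∑₁ 1 n (λ k → + k * ω (+ n - + k)) ⟩
  ∑₁ n (λ k → + k * ω (+ n - + k))
    ≡⟨ ∑₁-k*a[n-k]≡∑₁-φ*∑a[n-m-jm] ω (λ _ → refl) n ⟩
  ∑₁ n (λ m → + φ m * ∑₁ (suc (n ∸ m)) (λ j → ω (+ (n ∸ m) - + (pred j ℕ.* m))))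
    ≡⟨ ∑₁-cong n (λ m _ _ → cong (λ x → + φ m * x) (sumℤ≡∑₁ 0 (n ∸ m) (inner m))) ⟨
  ∑₁ n (λ m → + φ m * sumℤ 0 (n ∸ m) (inner m))
    ≡⟨ sumℤ≡∑₁ 1 n (λ m → + φ m * sumℤ 0 (n ∸ m) (inner m)) ⟨
  sumℤ 1 n (λ m → + φ m * sumℤ 0 (n ∸ m) (inner m)) ∎
  where
  inner : ℕ → ℕ → ℤ
  inner m j = ω (+ (n ∸ m) - + (j Data.Nat.* m))
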